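{- Let $n\ge 0$. 1. Let $\mathcal{M}$ be a model whose relation $R$ is weakly transitive. If every instance of $\mathbb{C}_n^*$ is true in $\mathcal{M}$, then every instance of $\mathbb{C}_n$ is true in $\mathcal{M}$. 2. $\mathbb{C}_n$ is included in any normal logic that includes all instances of w4 and of $\mathbb{C}_n^*$.
   Context: Modal formulas are built from variables by $\top,\neg,\wedge,\Box$, with $\Diamond=\neg\Box\neg$, $\Box^*\varphi=\varphi\wedge\Box\varphi$, $\Diamond^*\varphi=\varphi\vee\Diamond\varphi$. Models $(W,R,V)$ use standard Kripke semantics; a formula is true in a model if true at every point. $R$ is weakly transitive if $xRyRz$ implies $xRz$ or $x=z$. A normal logic is a set of formulas containing all tautologies and all instances of $\Box(\varphi\to\psi)\to(\Box\varphi\to\Box\psi)$, closed under modus ponens, $\Box$-generalisation and uniform substitution. w4 is the scheme $\Diamond\Diamond\varphi\to\Diamond^*\varphi$. Define $\mathbb{P}_0(\varphi_0)=\Diamond\varphi_0$ and for $n>0$, $\mathbb{P}_n(\varphi_0,\dots,\varphi_n)=\Diamond(\varphi_1\wedge\mathbb{P}_{n-1}(\varphi_0,\varphi_2,\dots,\varphi_n))$; $\mathbb{D}_n(\varphi_0,\dots,\varphi_n)=\bigwedge_{i<j\le n}\neg(\varphi_i\wedge\varphi_j)$ ($=\top$ if $n=0$). $\mathbb{C}_n$ is the scheme $\Box^*\mathbb{D}_n(\varphi_0,\dots,\varphi_n)\to(\Diamond\varphi_0\to\Diamond(\varphi_0\wedge\neg\mathbb{P}_n(\varphi_0,\dots,\varphi_n)))$,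 and $\mathbb{C}_n^*$ is the scheme $\Box^*\mathbb{D}_n(\varphi_0,\dots,\varphi_n)\to(\Diamond\varphi_0\to\Diamond^*(\varphi_0\wedge\neg\mathbb{P}_n(\varphi_0,\dots,\varphi_n)))$, where the $\varphi_i$ range over all formulas. -}

module Defs where

open import Data.Nat using (ℕ; zero; suc)
open import Data.Bool using (Bool; true; false; not; _∧_)
open import Data.List using (List; []; _∷_; map; _++_)
open import Data.Vec using (Vec; toList)
open import Data.Unit using (⊤)
open import Data.Empty using (⊥)
open import Data.Product using (_×_)
open import Data.Sum using (_⊎_)
open import Relation.Binary.PropositionalEquality using (_≡_)

data Fm : Set where
  var  : ℕ → Fm
  ⊤'   : Fm
  ¬'_  : Fm → Fm
  _∧'_ : Fm → Fm → Fm
  □_   : Fm → Fm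

infixr 6 _∧'_
infixr 4 _⇒'_
infixr 5 _∨'_
infix 7 ¬'_ □_ ◇_ □*_ ◇*_

_⇒'_ : Fm → Fm → Fm
φ ⇒' ψ = ¬' (φ ∧' ¬' ψ)

_∨'_ : Fm → Fm → Fm
φ ∨' ψ = ¬' (¬' φ ∧' ¬' ψ)

◇_ : Fm → Fm
◇ φ = ¬' □ ¬' φ

□*_ : Fm → Fm
□* φ = φ ∧' □ φ

◇*_ : Fm → Fm
◇* φ = φ ∨' ◇ φ

⋀ : List Fm → Fm
⋀ [] = ⊤'
⋀ (φ ∷ []) = φ
⋀ (φ ∷ ψ ∷ ψs) = φ ∧' ⋀ (ψ ∷ ψs)

disjPairs : List Fm → List Fm
disjPairs [] = []
disjPairs (φ ∷ φs) = map (λ ψ → ¬' (φ ∧' ψ)) φs ++ disjPairs φs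

𝔻 : ∀ {n} → Fm → Vec Fm n → Fm
𝔻 φ₀ φs = ⋀ (disjPairs (φ₀ ∷ toList φs))

ℙ : ∀ {n} → Fm → Vec Fm n → Fm
ℙ φ₀ Vec.[] = ◇ φ₀
ℙ φ₀ (φ₁ Vec.∷ φs) = ◇ (φ₁ ∧' ℙ φ₀ φs)

ℂ : ∀ {n} → Fm → Vec Fm n → Fm
ℂ φ₀ φs = □* 𝔻 φ₀ φs ⇒' (◇ φ₀ ⇒' ◇ (φ₀ ∧' ¬' ℙ φ₀ φs))

ℂ* : ∀ {n} → Fm → Vec Fm n → Fm
ℂ* φ₀ φs = □* 𝔻 φ₀ φs ⇒' (◇ φ₀ ⇒' ◇* (φ₀ ∧' ¬' ℙ φ₀ φs))

w4 : Fm → Fm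
w4 φ = ◇ ◇ φ ⇒' ◇* φ

record Model : Set₁ where
  field
    W : Set
    R : W → W → Set
    V : ℕ → W → Set

open Model public

infix 2 _,_⊨_ _⊨_
_,_⊨_ : (M : Model) → W M → Fm → Set
M , w ⊨ var p = V M p w
M , w ⊨ ⊤' = ⊤
M , w ⊨ (¬' φ) = M , w ⊨ φ → ⊥
M , w ⊨ (φ ∧' ψ) = (M , w ⊨ φ) × (M , w ⊨ ψ)
M , w ⊨ (□ φ) = ∀ v → R M w v → M , v ⊨ φ

_⊨_ : Model → Fm → Set
M ⊨ φ = ∀ w → M , w ⊨ φ

WeaklyTransitive : Model → Set
WeaklyTransitive M = ∀ x y z → R M x y → R M y z → R M x z ⊎ x ≡ z

-- Propositional tautologies: true under every Boolean valuation of the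
-- variables and of the boxed subformulas (treated as atoms)
evalB : (ℕ → Bool) → (Fm → Bool) → Fm → Bool
evalB v b (var p) = v p
evalB v b ⊤' = true
evalB v b (¬' φ) = not (evalB v b φ)
evalB v b (φ ∧' ψ) = evalB v b φ ∧ evalB v b ψ
evalB v b (□ φ) = b φ

Tautology : Fm → Set
Tautology φ = ∀ v b → evalB v b φ ≡ true

subst : (ℕ → Fm) → Fm → Fm
subst σ (var p) = σ p
subst σ ⊤' = ⊤'
subst σ (¬' φ) = ¬' subst σ φ
subst σ (φ ∧' ψ) = subst σ φ ∧' subst σ ψ
subst σ (□ φ) = □ subst σ φ

record NormalLogic (L : Fm → Set) : Set where
  field
    taut : ∀ φ → Tautology φ → L φ
    K    : ∀ φ ψ → L (□ (φ ⇒' ψ) ⇒' (□ φ ⇒' □ ψ))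
    MP   : ∀ φ ψ → L φ → L (φ ⇒' ψ) → L ψ
    Gen  : ∀ φ → L φ → L (□ φ)
    US   : ∀ σ φ → L φ → L (subst σ φ)

-- Write P = ℙ(φ₀, φ₁, …, φₙ) = ◇X with X = φ₁ ∧ ℙ(φ₀, φ₂, …, φₙ). Suppose □*𝔻 and ◇φ₀ but
-- □(φ₀ → P). Then ◇P = ◇◇X, so w4 gives X ∨ P; and ℂ*ₙ, whose alternative ◇(φ₀ ∧ ¬P) is ruled
-- out by □(φ₀ → P), gives φ₀ ∧ ¬P. Now X contradicts φ₀ through the conjunct ¬(φ₀ ∧ φ₁) of 𝔻,
-- and P contradicts ¬P. For n = 0, ℙ = ◇φ₀, so ◇φ₀ alone rules out φ₀ ∧ ¬P.
-- The argument is intuitionistic and uses ¬ and ∧ only through their introduction and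
-- elimination rules, so it runs in every Interpretation: at a point of a weakly transitive
-- model, which validates w4, and under Boolean valuations, where it yields a tautology that
-- L applies by modus ponens.
module Submission where

open import Defs
open import Data.Nat using (ℕ)
open import Data.Vec using (Vec; []; _∷_; toList)
open import Data.List using (List; map; _++_)
open import Data.Bool using (Bool; true; false; not; T)
open import Data.Bool.Properties using (T-≡; T-∧)
open import Data.Product using (_×_; _,_; proj₁; proj₂)
open import Data.Sum using ([_,_])
open import Data.Empty using (⊥; ⊥-elim)
open import Function.Bundles using (Equivalence)
open import Relation.Nullary using (¬_)
open import Relation.Binary.PropositionalEquality using (sym) renaming (subst to ≡-subst)

K◇ : Fm → Fm → Fm
K◇ φ ψ = □ (φ ⇒' ψ) ⇒' (◇ φ ⇒' ◇ ψ)

record Interpretation : Set₁ where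
  field
    ⟦_⟧     : Fm → Set
    ¬-intro : ∀ {φ} → ¬ ⟦ φ ⟧ → ⟦ ¬' φ ⟧
    ¬-elim  : ∀ {φ} → ⟦ ¬' φ ⟧ → ¬ ⟦ φ ⟧
    ∧-intro : ∀ {φ ψ} → ⟦ φ ⟧ → ⟦ ψ ⟧ → ⟦ φ ∧' ψ ⟧
    ∧-elim  : ∀ {φ ψ} → ⟦ φ ∧' ψ ⟧ → ⟦ φ ⟧ × ⟦ ψ ⟧

module Reasoning (I : Interpretation) where
  open Interpretation I public

  ⇒-intro : ∀ {φ ψ} → (⟦ φ ⟧ → ¬ ¬ ⟦ ψ ⟧) → ⟦ φ ⇒' ψ ⟧
  ⇒-intro f = ¬-intro λ p → f (proj₁ (∧-elim p)) (¬-elim (proj₂ (∧-elim p)))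

  ⇒-elim : ∀ {φ ψ} → ⟦ φ ⇒' ψ ⟧ → ⟦ φ ⟧ → ¬ ¬ ⟦ ψ ⟧
  ⇒-elim h a ¬b = ¬-elim h (∧-intro a (¬-intro ¬b))

  ∨-elim : ∀ {φ ψ} → ⟦ φ ∨' ψ ⟧ → ¬ ⟦ φ ⟧ → ¬ ⟦ ψ ⟧ → ⊥
  ∨-elim h ¬a ¬b = ¬-elim h (∧-intro (¬-intro ¬a) (¬-intro ¬b))

  contraposition : ∀ {φ ψ} → ⟦ (φ ⇒' ψ) ⇒' (¬' ψ ⇒' ¬' φ) ⟧
  contraposition = ⇒-intro λ h k → k (⇒-intro λ ¬b k′ →
    k′ (¬-intro λ a → ⇒-elim h a (¬-elim ¬b)))

  ⋀-head : ∀ {φ} φs → ⟦ ⋀ (φ List.∷ φs) ⟧ → ⟦ φ ⟧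
  ⋀-head List.[]      h = h
  ⋀-head (_ List.∷ _) h = proj₁ (∧-elim h)

  𝔻-head : ∀ {n φ₀ φ₁} (φs : Vec Fm n) → ⟦ 𝔻 φ₀ (φ₁ ∷ φs) ⟧ → ¬ (⟦ φ₀ ⟧ × ⟦ φ₁ ⟧)
  𝔻-head {φ₀ = φ₀} {φ₁} φs d (a , b) =
    ¬-elim (⋀-head (map (λ ψ → ¬' (φ₀ ∧' ψ)) (toList φs) ++ disjPairs (φ₁ List.∷ toList φs)) d)
      (∧-intro a b)

  K◇-from-K : ∀ {A B C D} → ⟦ A ⇒' B ⟧ → ⟦ B ⇒' (C ⇒' D) ⟧ → ⟦ A ⇒' (¬' D ⇒' ¬' C) ⟧
  K◇-from-K h₁ h₂ = ⇒-intro λ a k → k (⇒-intro λ ¬d k′ → k′ (¬-intro λ c →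
    ⇒-elim h₁ a λ b → ⇒-elim h₂ b λ h₃ → ⇒-elim h₃ c (¬-elim ¬d)))

  ℂ₀-from-ℂ*₀ : ∀ φ₀ → ⟦ ℂ* φ₀ [] ⟧ → ⟦ ℂ φ₀ [] ⟧
  ℂ₀-from-ℂ*₀ φ₀ c* = ⇒-intro λ d k → k (⇒-intro λ ◇φ₀ ¬goal →
    ⇒-elim c* d λ c′ → ⇒-elim c′ ◇φ₀ λ alternatives →
    ∨-elim alternatives (λ here → ¬-elim (proj₂ (∧-elim here)) ◇φ₀) ¬goal)

  ℂ-from-ℂ* : ∀ {n} φ₀ φ₁ (φs : Vec Fm n) →
    let P = ℙ φ₀ (φ₁ ∷ φs) in
    ⟦ ℂ* φ₀ (φ₁ ∷ φs) ⟧ → ⟦ K◇ φ₀ P ⟧ → ⟦ w4 (φ₁ ∧' ℙ φ₀ φs) ⟧ → ⟦ ℂ φ₀ (φ₁ ∷ φs) ⟧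
  ℂ-from-ℂ* φ₀ φ₁ φs c* k◇ w = ⇒-intro λ d k → k (⇒-intro λ ◇φ₀ ¬goal →
    ¬goal (¬-intro λ □φ₀⇒P →
    ⇒-elim k◇ □φ₀⇒P λ k◇′ → ⇒-elim k◇′ ◇φ₀ λ ◇P →
    ⇒-elim c* d λ c′ → ⇒-elim c′ ◇φ₀ λ alternatives →
    ∨-elim alternatives
      (λ here → let φ₀-here , ¬P-here = ∧-elim here in
        ⇒-elim w ◇P λ X∨P → ∨-elim X∨P
          (λ X → 𝔻-head φs (proj₁ (∧-elim d)) (φ₀-here , proj₁ (∧-elim X)))
          (¬-elim ¬P-here))
      (λ there → ¬-elim there □φ₀⇒P)))

module _ (M : Model) where

  at : W M → Interpretation
  at w = record
    { ⟦_⟧     = _,_⊨_ M w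
    ; ¬-intro = λ ¬a → ¬a
    ; ¬-elim  = λ ¬a → ¬a
    ; ∧-intro = _,_
    ; ∧-elim  = λ p → p
    }

  ⊨-K◇ : ∀ φ ψ → M ⊨ K◇ φ ψ
  ⊨-K◇ φ ψ w (□φ⇒ψ , k) = k λ (◇φ , ¬◇ψ) →
    ¬◇ψ λ □¬ψ → ◇φ λ v wRv φv → □φ⇒ψ v wRv (φv , □¬ψ v wRv)

  weaklyTransitive⇒⊨w4 : WeaklyTransitive M → ∀ φ → M ⊨ w4 φ
  weaklyTransitive⇒⊨w4 wt φ w (◇◇φ , ¬◇*φ) = ◇◇φ λ v wRv ◇φ-at-v → ◇φ-at-v λ x vRx φx →
    ¬◇*φ λ (¬φ , ¬◇φ) → [ (λ wRx → ¬◇φ λ □¬φ → □¬φ x wRx φx)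
                        , (λ w≡x → ¬φ (≡-subst (λ y → _,_⊨_ M y φ) (sym w≡x) φx))
                        ] (wt w v x wRv vRx)

  ⊨ℂ*⇒⊨ℂ : WeaklyTransitive M → ∀ {n} φ₀ (φs : Vec Fm n) → M ⊨ ℂ* φ₀ φs → M ⊨ ℂ φ₀ φs
  ⊨ℂ*⇒⊨ℂ _  φ₀ []        ⊨ℂ* w = Reasoning.ℂ₀-from-ℂ*₀ (at w) φ₀ (⊨ℂ* w)
  ⊨ℂ*⇒⊨ℂ wt φ₀ (φ₁ ∷ φs) ⊨ℂ* w =
    Reasoning.ℂ-from-ℂ* (at w) φ₀ φ₁ φs (⊨ℂ* w) (⊨-K◇ φ₀ (ℙ φ₀ (φ₁ ∷ φs)) w)
      (weaklyTransitive⇒⊨w4 wt (φ₁ ∧' ℙ φ₀ φs) w)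

T-not⁺ : ∀ {x} → ¬ T x → T (not x)
T-not⁺ {false} _  = _
T-not⁺ {true}  ¬t = ⊥-elim (¬t _)

T-not⁻ : ∀ {x} → T (not x) → ¬ T x
T-not⁻ {false} _ ()

record Holds (v : ℕ → Bool) (b : Fm → Bool) (φ : Fm) : Set where
  constructor holds
  field truth : T (evalB v b φ)

boolean : (ℕ → Bool) → (Fm → Bool) → Interpretation
boolean v b = record
  { ⟦_⟧     = Holds v b
  ; ¬-intro = λ ¬h → holds (T-not⁺ λ t → ¬h (holds t))
  ; ¬-elim  = λ (holds t) (holds u) → T-not⁻ t u
  ; ∧-intro = λ (holds t) (holds u) → holds (Equivalence.from T-∧ (t , u))
  ; ∧-elim  = λ (holds t) → let t₁ , t₂ = Equivalence.to T-∧ t in holds t₁ , holds t₂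
  }

module InNormalLogic {L : Fm → Set} (NL : NormalLogic L) where
  open NormalLogic NL
  open module Boolean v b = Reasoning (boolean v b)

  tautology : ∀ {φ} → (∀ v b → Holds v b φ) → L φ
  tautology {φ} t = taut φ λ v b → Equivalence.to T-≡ (Holds.truth (t v b))

  infer : ∀ {φ ψ} → (∀ v b → Holds v b φ → Holds v b ψ) → L φ → L ψ
  infer {φ} {ψ} f ⊢φ = MP φ ψ ⊢φ (tautology λ v b → ⇒-intro v b λ x k → k (f v b x))

  infixr 6 _∧ᴸ_
  _∧ᴸ_ : ∀ {φ ψ} → L φ → L ψ → L (φ ∧' ψ)
  _∧ᴸ_ {φ} {ψ} ⊢φ ⊢ψ =
    MP ψ (φ ∧' ψ) ⊢ψ (infer (λ v b x → ⇒-intro v b λ y k → k (∧-intro v b x y)) ⊢φ)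

  ⊢K◇ : ∀ φ ψ → L (K◇ φ ψ)
  ⊢K◇ φ ψ = infer (λ v b h → K◇-from-K v b (proj₁ (∧-elim v b h)) (proj₂ (∧-elim v b h)))
    (MP _ _ (Gen _ (tautology λ v b → contraposition v b)) (K (φ ⇒' ψ) (¬' ψ ⇒' ¬' φ))
      ∧ᴸ K (¬' ψ) (¬' φ))

  ⊢ℂ*⇒⊢ℂ : (∀ φ → L (w4 φ)) → ∀ {n} φ₀ (φs : Vec Fm n) → L (ℂ* φ₀ φs) → L (ℂ φ₀ φs)
  ⊢ℂ*⇒⊢ℂ _    φ₀ []        ⊢ℂ* = infer (λ v b → ℂ₀-from-ℂ*₀ v b φ₀) ⊢ℂ*
  ⊢ℂ*⇒⊢ℂ ⊢w4 φ₀ (φ₁ ∷ φs) ⊢ℂ* = infer premises⇒ℂ (⊢ℂ* ∧ᴸ ⊢K◇ φ₀ _ ∧ᴸ ⊢w4 _)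
    where
    premises⇒ℂ : ∀ v b →
      Holds v b (ℂ* φ₀ (φ₁ ∷ φs) ∧' K◇ φ₀ (ℙ φ₀ (φ₁ ∷ φs)) ∧' w4 (φ₁ ∧' ℙ φ₀ φs)) →
      Holds v b (ℂ φ₀ (φ₁ ∷ φs))
    premises⇒ℂ v b h = let c* , h′ = ∧-elim v b h ; k◇ , w = ∧-elim v b h′ in
      ℂ-from-ℂ* v b φ₀ φ₁ φs c* k◇ w

theorem5p2 : (n : ℕ) →
    ((M : Model) → WeaklyTransitive M →
      (∀ (φ₀ : Fm) (φs : Vec Fm n) → M ⊨ ℂ* φ₀ φs) →
      (∀ (φ₀ : Fm) (φs : Vec Fm n) → M ⊨ ℂ φ₀ φs))
    × ((L : Fm → Set) → NormalLogic L →
      (∀ φ → L (w4 φ)) →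
      (∀ (φ₀ : Fm) (φs : Vec Fm n) → L (ℂ* φ₀ φs)) →
      (∀ (φ₀ : Fm) (φs : Vec Fm n) → L (ℂ φ₀ φs)))
theorem5p2 n =
  (λ M wt ⊨ℂ* φ₀ φs → ⊨ℂ*⇒⊨ℂ M wt φ₀ φs (⊨ℂ* φ₀ φs)) ,
  (λ L NL ⊢w4 ⊢ℂ* φ₀ φs → InNormalLogic.⊢ℂ*⇒⊢ℂ NL ⊢w4 φ₀ φs (⊢ℂ* φ₀ φs))
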